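{- Let $t(\bar x,y)$ be a term with exactly one occurrence of the variable $y$, where $\bar x=x_1,\dots,x_n$, and let $\bar a b$ be an independent tuple in a Steiner quasigroup with $\bar a=a_1,\dots,a_n$. Then the homomorphism of $\langle\bar a b\rangle$ induced by $a_i\mapsto a_i$ ($i=1,\dots,n$) and $b\mapsto t(\bar a,b)$ is an automorphism of $\langle\bar a b\rangle$.
   Context: A Steiner quasigroup is a set with a binary operation $\cdot$ satisfying $x\cdot y=y\cdot x$, $x\cdot x=x$, $x\cdot(x\cdot y)=y$. A tuple is independent if its entries are pairwise distinct and the substructure they generate is freely generated by them (every map from the entries to a Steiner quasigroup extends to a homomorphism). Terms are built from variables by the binary product. -}

module Defs where

open import Data.Nat using (ℕ; zero; suc; _+_)
open import Data.Fin using (Fin)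
open import Data.Maybe using (Maybe; just; nothing)
open import Data.Product using (Σ; ∃; _×_; _,_)
open import Function.Definitions using (Injective)
open import Relation.Binary.PropositionalEquality using (_≡_)

record SteinerQuasigroup : Set₁ where
  infixl 7 _·_
  field
    Carrier : Set
    _·_     : Carrier → Carrier → Carrier
    comm    : ∀ x y → x · y ≡ y · x
    idem    : ∀ x → x · x ≡ x
    cancel  : ∀ x y → x · (x · y) ≡ y

data Term (V : Set) : Set where
  var : V → Term V
  _∙_ : Term V → Term V → Term V

eval : (Q : SteinerQuasigroup) {V : Set} →
       (V → SteinerQuasigroup.Carrier Q) → Term V → SteinerQuasigroup.Carrier Q
eval Q ρ (var v) = ρ v
eval Q ρ (s ∙ t) = SteinerQuasigroup._·_ Q (eval Q ρ s) (eval Q ρ t)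

-- Variables x₁ … xₙ (just i) and y (nothing)
Var : ℕ → Set
Var n = Maybe (Fin n)

occY : {n : ℕ} → Term (Var n) → ℕ
occY (var (just _)) = 0
occY (var nothing)  = 1
occY (s ∙ t)        = occY s + occY t

module _ (Q : SteinerQuasigroup) where
  open SteinerQuasigroup Q

  -- membership in the substructure ⟨ c ⟩ generated by the entries of the tuple c
  InGen : {V : Set} → (V → Carrier) → Carrier → Set
  InGen c x = ∃ λ (t : Term _) → eval Q c t ≡ x

  -- h (a function on the whole carrier, only its restriction to ⟨ c ⟩ matters)
  -- is a homomorphism ⟨ c ⟩ → R
  IsHomOn : {V : Set} → (V → Carrier) → (R : SteinerQuasigroup) →
            (Carrier → SteinerQuasigroup.Carrier R) → Set
  IsHomOn c R h = ∀ x y → InGen c x → InGen c y →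
                  h (x · y) ≡ SteinerQuasigroup._·_ R (h x) (h y)

  Independent : {V : Set} → (V → Carrier) → Set₁
  Independent {V} c =
    Injective _≡_ _≡_ c ×
    ((R : SteinerQuasigroup) (f : V → SteinerQuasigroup.Carrier R) →
       Σ (Carrier → SteinerQuasigroup.Carrier R) λ h →
         IsHomOn c R h × (∀ v → h (c v) ≡ f v))

  IsAutOn : {V : Set} → (V → Carrier) → (Carrier → Carrier) → Set
  IsAutOn c h =
    IsHomOn c Q h ×
    (∀ x → InGen c x → InGen c (h x)) ×
    (∀ x y → InGen c x → InGen c y → h x ≡ h y → x ≡ y) ×
    (∀ y → InGen c y → ∃ λ x → InGen c x × h x ≡ y)

{-# OPTIONS --safe #-}
module Submission where

-- A term with exactly one occurrence of y is a chain y ↦ s₁ · (s₂ · (⋯ (sₖ · y)))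
-- of multiplications by y-free terms. In a Steiner quasigroup each z ↦ s · z is an
-- involution, so the unary polynomial w ↦ t(ā, w) has the polynomial inverse
-- w ↦ sₖ · (⋯ (s₁ · w)). By independence, ā ↦ ā, b ↦ t⁻¹(ā, b) extends to a
-- homomorphism g. Homomorphisms fixing ā commute with polynomials over ā, so the
-- induced h and g are mutually inverse on ⟨ā b⟩.

open import Defs
open import Data.Nat using (ℕ; zero)
open import Data.Fin using (Fin)
open import Data.Maybe using (just; nothing; maybe′)
open import Data.Product using (Σ; _×_; _,_; proj₁)
open import Function using (_∘_)
open import Relation.Binary.PropositionalEquality
  using (_≡_; _≗_; refl; trans; cong; cong₂; module ≡-Reasoning)

module _ (Q : SteinerQuasigroup) where
  open SteinerQuasigroup Q
  open ≡-Reasoning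

  eval-cong : ∀ {V} {ρ σ : V → Carrier} → ρ ≗ σ → ∀ s → eval Q ρ s ≡ eval Q σ s
  eval-cong ρ≗σ (var v) = ρ≗σ v
  eval-cong ρ≗σ (s ∙ r) = cong₂ _·_ (eval-cong ρ≗σ s) (eval-cong ρ≗σ r)

  module _ {V : Set} {c : V → Carrier} where

    InGen-∙ : ∀ {x y} → InGen Q c x → InGen Q c y → InGen Q c (x · y)
    InGen-∙ (s , refl) (r , refl) = s ∙ r , refl

    InGen-eval : ∀ {W} {ρ : W → Carrier} → (∀ w → InGen Q c (ρ w)) →
                 ∀ s → InGen Q c (eval Q ρ s)
    InGen-eval ρ∈ (var w) = ρ∈ w
    InGen-eval ρ∈ (s ∙ r) = InGen-∙ (InGen-eval ρ∈ s) (InGen-eval ρ∈ r)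

    hom-eval : ∀ {R h} → IsHomOn Q c R h → ∀ {W} {ρ : W → Carrier} →
               (∀ w → InGen Q c (ρ w)) →
               ∀ s → h (eval Q ρ s) ≡ eval R (h ∘ ρ) s
    hom-eval hom ρ∈ (var w) = refl
    hom-eval {R} {h} hom {ρ = ρ} ρ∈ (s ∙ r) = begin
      h (eval Q ρ s · eval Q ρ r)
        ≡⟨ hom _ _ (InGen-eval ρ∈ s) (InGen-eval ρ∈ r) ⟩
      SteinerQuasigroup._·_ R (h (eval Q ρ s)) (h (eval Q ρ r))
        ≡⟨ cong₂ (SteinerQuasigroup._·_ R) (hom-eval hom ρ∈ s) (hom-eval hom ρ∈ r) ⟩
      eval R (h ∘ ρ) (s ∙ r) ∎

  module _ {n : ℕ} where

    poly : (Fin n → Carrier) → Term (Var n) → Carrier → Carrier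
    poly a s w = eval Q (maybe′ a w) s

    y : Term (Var n)
    y = var nothing

    infixl 30 _⟪_⟫
    _⟪_⟫ : Term (Var n) → Term (Var n) → Term (Var n)
    var (just i) ⟪ w ⟫ = var (just i)
    var nothing  ⟪ w ⟫ = w
    (s ∙ r)      ⟪ w ⟫ = s ⟪ w ⟫ ∙ r ⟪ w ⟫

    poly-⟪⟫ : ∀ a u w x → poly a (u ⟪ w ⟫) x ≡ poly a u (poly a w x)
    poly-⟪⟫ a (var (just i)) w x = refl
    poly-⟪⟫ a (var nothing)  w x = refl
    poly-⟪⟫ a (s ∙ r)        w x = cong₂ _·_ (poly-⟪⟫ a s w x) (poly-⟪⟫ a r w x)

    poly-const : ∀ s → occY s ≡ 0 → ∀ a w w′ → poly a s w ≡ poly a s w′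
    poly-const (var (just i)) _ a w w′ = refl
    poly-const (s ∙ r) s∌y a w w′ with occY s in s-occ | occY r in r-occ
    ... | zero | zero = cong₂ _·_ (poly-const s s-occ a w w′) (poly-const r r-occ a w w′)

    data Linear : Term (Var n) → Set where
      hole : Linear y
      _∙ʳ_ : ∀ {s r} → occY s ≡ 0 → Linear r → Linear (s ∙ r)
      _∙ˡ_ : ∀ {s r} → Linear s → occY r ≡ 0 → Linear (s ∙ r)

    linear : ∀ t → occY t ≡ 1 → Linear t
    linear (var nothing) _ = hole
    linear (s ∙ r) once with occY s in s-occ | occY r in r-occ
    ... | 0 | 1 = s-occ ∙ʳ linear r r-occ
    ... | 1 | 0 = linear s s-occ ∙ˡ r-occ

    inverse : ∀ {t} → Linear t → Term (Var n)
    inverse hole               = y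
    inverse (_∙ʳ_ {s = s} _ L) = inverse L ⟪ s ∙ y ⟫
    inverse (_∙ˡ_ {r = r} L _) = inverse L ⟪ r ∙ y ⟫

    undo-factor : ∀ s → occY s ≡ 0 → ∀ a u w z →
                  poly a (u ⟪ s ∙ y ⟫) (poly a s w · z) ≡ poly a u z
    undo-factor s s∌y a u w z = begin
      poly a (u ⟪ s ∙ y ⟫) (poly a s w · z)               ≡⟨ poly-⟪⟫ a u (s ∙ y) _ ⟩
      poly a u (poly a s (poly a s w · z) · (poly a s w · z))
        ≡⟨ cong (λ v → poly a u (v · (poly a s w · z))) (poly-const s s∌y a _ w) ⟩
      poly a u (poly a s w · (poly a s w · z))             ≡⟨ cong (poly a u) (cancel _ z) ⟩
      poly a u z                                           ∎

    redo-factor : ∀ s r → occY s ≡ 0 → ∀ a u → (∀ z → poly a r (poly a u z) ≡ z) →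
                  ∀ x w → poly a s x · poly a r (poly a (u ⟪ s ∙ y ⟫) w) ≡ w
    redo-factor s r s∌y a u r∘u≗id x w = begin
      poly a s x · poly a r (poly a (u ⟪ s ∙ y ⟫) w)
        ≡⟨ cong₂ _·_ (poly-const s s∌y a x w) (cong (poly a r) (poly-⟪⟫ a u (s ∙ y) w)) ⟩
      poly a s w · poly a r (poly a u (poly a s w · w))   ≡⟨ cong (poly a s w ·_) (r∘u≗id _) ⟩
      poly a s w · (poly a s w · w)                       ≡⟨ cancel _ w ⟩
      w                                                   ∎

    inverse-left : ∀ {t} (L : Linear t) a w → poly a (inverse L) (poly a t w) ≡ w
    inverse-left hole a w = refl
    inverse-left (_∙ʳ_ {s} s∌y L) a w =
      trans (undo-factor s s∌y a (inverse L) w _) (inverse-left L a w)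
    inverse-left (_∙ˡ_ {s} {r} L r∌y) a w = begin
      poly a (inverse L ⟪ r ∙ y ⟫) (poly a s w · poly a r w)
        ≡⟨ cong (poly a (inverse L ⟪ r ∙ y ⟫)) (comm _ _) ⟩
      poly a (inverse L ⟪ r ∙ y ⟫) (poly a r w · poly a s w)
        ≡⟨ undo-factor r r∌y a (inverse L) w _ ⟩
      poly a (inverse L) (poly a s w)                      ≡⟨ inverse-left L a w ⟩
      w                                                    ∎

    inverse-right : ∀ {t} (L : Linear t) a w → poly a t (poly a (inverse L) w) ≡ w
    inverse-right hole a w = refl
    inverse-right (_∙ʳ_ {s} {r} s∌y L) a w =
      redo-factor s r s∌y a (inverse L) (inverse-right L a) _ w
    inverse-right (_∙ˡ_ {s} {r} L r∌y) a w =
      trans (comm _ _) (redo-factor r s r∌y a (inverse L) (inverse-right L a) _ w)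

  module _ {n : ℕ} (c : Var n → Carrier) where

    private
      ā : Fin n → Carrier
      ā = c ∘ just

      b : Carrier
      b = c nothing

    eval-as-poly : ∀ s → eval Q c s ≡ poly ā s b
    eval-as-poly = eval-cong λ { (just i) → refl ; nothing → refl }

    InGen-poly : ∀ {w} → InGen Q c w → ∀ s → InGen Q c (poly ā s w)
    InGen-poly w∈ = InGen-eval λ { (just i) → var (just i) , refl ; nothing → w∈ }

    FixesGenerators : (Carrier → Carrier) → Set
    FixesGenerators h = IsHomOn Q c Q h × (∀ i → h (ā i) ≡ ā i)

    hom-poly : ∀ {h} → FixesGenerators h → ∀ {w} → InGen Q c w →
               ∀ s → h (poly ā s w) ≡ poly ā s (h w)
    hom-poly (hom , fix) w∈ s =
      trans (hom-eval hom (λ { (just i) → var (just i) , refl ; nothing → w∈ }) s)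
            (eval-cong (λ { (just i) → fix i ; nothing → refl }) s)

    module _ {h : Carrier → Carrier} (p : Term (Var n))
             (h-fix : FixesGenerators h) (h-b : h b ≡ poly ā p b) where

      hom-poly-b : ∀ s → h (poly ā s b) ≡ poly ā s (poly ā p b)
      hom-poly-b s = trans (hom-poly h-fix (y , refl) s) (cong (poly ā s) h-b)

      InGen-image : ∀ x → InGen Q c x → InGen Q c (h x)
      InGen-image _ (s , refl) rewrite eval-as-poly s | hom-poly-b s =
        InGen-poly (InGen-poly (y , refl) p) s

      inverse-on-gen : ∀ {g} q → FixesGenerators g → g b ≡ poly ā q b →
                       (∀ w → poly ā p (poly ā q w) ≡ w) →
                       ∀ x → InGen Q c x → g (h x) ≡ x
      inverse-on-gen {g} q g-fix g-b p∘q≗id _ (s , refl) = begin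
        g (h (eval Q c s))                    ≡⟨ cong (g ∘ h) (eval-as-poly s) ⟩
        g (h (poly ā s b))                    ≡⟨ cong g (hom-poly-b s) ⟩
        g (poly ā s (poly ā p b))             ≡⟨ hom-poly g-fix (InGen-poly (y , refl) p) s ⟩
        poly ā s (g (poly ā p b))             ≡⟨ cong (poly ā s) (hom-poly g-fix (y , refl) p) ⟩
        poly ā s (poly ā p (g b))             ≡⟨ cong (poly ā s ∘ poly ā p) g-b ⟩
        poly ā s (poly ā p (poly ā q b))      ≡⟨ cong (poly ā s) (p∘q≗id b) ⟩
        poly ā s b                            ≡˘⟨ eval-as-poly s ⟩
        eval Q c s                            ∎

    extend-fixing : Independent Q c → ∀ w →
                    Σ (Carrier → Carrier) λ h →
                      IsHomOn Q c Q h × (∀ i → h (ā i) ≡ ā i) × h b ≡ w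
    extend-fixing (_ , extend) w with extend Q (maybe′ ā w)
    ... | h , hom , h-c = h , hom , h-c ∘ just , h-c nothing

    isAut-of-invertible : Independent Q c → ∀ {h} p q →
                          FixesGenerators h → h b ≡ poly ā p b →
                          (∀ w → poly ā q (poly ā p w) ≡ w) →
                          (∀ w → poly ā p (poly ā q w) ≡ w) → IsAutOn Q c h
    isAut-of-invertible indep {h} p q h-fix h-b q∘p≗id p∘q≗id
      with extend-fixing indep (poly ā q b)
    ... | g , g-hom , g-fix′ , g-b =
      proj₁ h-fix , InGen-image p h-fix h-b , injective , surjective
      where
      g-fix : FixesGenerators g
      g-fix = g-hom , g-fix′

      injective : ∀ x x′ → InGen Q c x → InGen Q c x′ → h x ≡ h x′ → x ≡ x′
      injective x x′ x∈ x′∈ hx≡hx′ = begin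
        x          ≡˘⟨ inverse-on-gen p h-fix h-b q g-fix g-b p∘q≗id x x∈ ⟩
        g (h x)    ≡⟨ cong g hx≡hx′ ⟩
        g (h x′)   ≡⟨ inverse-on-gen p h-fix h-b q g-fix g-b p∘q≗id x′ x′∈ ⟩
        x′         ∎

      surjective : ∀ x → InGen Q c x → Σ Carrier λ x′ → InGen Q c x′ × h x′ ≡ x
      surjective x x∈ =
        g x , InGen-image q g-fix g-b x x∈ ,
        inverse-on-gen q g-fix g-b p h-fix h-b q∘p≗id x x∈

proposition6p4 : (Q : SteinerQuasigroup) (n : ℕ) (t : Term (Var n)) →
    occY t ≡ 1 →
    (c : Var n → SteinerQuasigroup.Carrier Q) → Independent Q c →
    Σ (SteinerQuasigroup.Carrier Q → SteinerQuasigroup.Carrier Q) (λ h →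
        IsHomOn Q c Q h × (∀ i → h (c (just i)) ≡ c (just i))
          × h (c nothing) ≡ eval Q c t)
    × ((h : SteinerQuasigroup.Carrier Q → SteinerQuasigroup.Carrier Q) →
        IsHomOn Q c Q h → (∀ i → h (c (just i)) ≡ c (just i)) →
        h (c nothing) ≡ eval Q c t → IsAutOn Q c h)
proposition6p4 Q n t once c indep =
  extend-fixing Q c indep (eval Q c t) ,
  λ h hom fix h-b →
    isAut-of-invertible Q c indep t (inverse Q t-linear) (hom , fix)
      (trans h-b (eval-as-poly Q c t))
      (inverse-left Q t-linear (c ∘ just)) (inverse-right Q t-linear (c ∘ just))
  where
  t-linear : Linear Q t
  t-linear = linear Q t once
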